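{- The positive integer solutions $(x_1,x_2,x_3,y_1,y_2,y_3)$ of the system $x_1y_1=x_2+1$, $x_2y_2=x_1+x_3$, $x_3y_3=x_2+1$ are exactly the $14$ tuples $(1,1,1,2,2,2)$, $(1,1,2,2,3,1)$, $(1,2,1,3,1,3)$, $(1,2,3,3,2,1)$, $(1,3,2,4,1,2)$, $(2,1,1,1,3,2)$, $(2,1,2,1,4,1)$, $(2,3,1,2,1,4)$, $(2,3,4,2,2,1)$, $(2,5,3,3,1,2)$, $(3,2,1,1,2,3)$, $(3,2,3,1,3,1)$, $(3,5,2,2,1,3)$, $(4,3,2,1,2,2)$. -}

module Defs where

open import Data.Nat using (ℕ; _+_; _*_; _≤_)
open import Data.Product using (_×_; _,_)
open import Data.List using (List; _∷_; [])
open import Relation.Binary.PropositionalEquality using (_≡_)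

Tuple : Set
Tuple = ℕ × ℕ × ℕ × ℕ × ℕ × ℕ

IsPositiveSolution : Tuple → Set
IsPositiveSolution (x₁ , x₂ , x₃ , y₁ , y₂ , y₃) =
  (1 ≤ x₁ × 1 ≤ x₂ × 1 ≤ x₃ × 1 ≤ y₁ × 1 ≤ y₂ × 1 ≤ y₃) ×
  (x₁ * y₁ ≡ x₂ + 1 × x₂ * y₂ ≡ x₁ + x₃ × x₃ * y₃ ≡ x₂ + 1)

solutionList : List Tuple
solutionList =
  (1 , 1 , 1 , 2 , 2 , 2) ∷
  (1 , 1 , 2 , 2 , 3 , 1) ∷
  (1 , 2 , 1 , 3 , 1 , 3) ∷
  (1 , 2 , 3 , 3 , 2 , 1) ∷
  (1 , 3 , 2 , 4 , 1 , 2) ∷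
  (2 , 1 , 1 , 1 , 3 , 2) ∷
  (2 , 1 , 2 , 1 , 4 , 1) ∷
  (2 , 3 , 1 , 2 , 1 , 4) ∷
  (2 , 3 , 4 , 2 , 2 , 1) ∷
  (2 , 5 , 3 , 3 , 1 , 2) ∷
  (3 , 2 , 1 , 1 , 2 , 3) ∷
  (3 , 2 , 3 , 1 , 3 , 1) ∷
  (3 , 5 , 2 , 2 , 1 , 3) ∷
  (4 , 3 , 2 , 1 , 2 , 2) ∷
  []

{-# OPTIONS --safe #-}

-- If y₁ = 1 then x₁ = x₂ + 1, and the other two equations say x₂ ∣ x₃ + 1 and x₃ ∣ x₂ + 1;
-- symmetrically when y₃ = 1, and when y₂ = 1 we get x₂ = x₁ + x₃ with x₁ ∣ x₃ + 1 and
-- x₃ ∣ x₁ + 1.  The pairs a, b with a ∣ b + 1 and b ∣ a + 1 are (1,1), (1,2), (2,1), (2,3)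
-- and (3,2): they differ by at most one, and a ∣ a + 1 or a ∣ a + 2 bounds the smaller one.
-- If every yᵢ ≥ 2, then 2x₁ and 2x₃ are at most x₂ + 1 while 2x₂ ≤ x₁ + x₃, which forces
-- x₁ = x₂ = x₃ = 1.  Since a positive solution is determined by (x₁, x₂, x₃), it remains to
-- compare these x-parts with those of the listed tuples.
module Submission where

open import Defs
open import Function.Bundles using (_⇔_; mk⇔)
open import Data.List.Membership.Propositional using (_∈_)
open import Data.List using (List; _∷_; []; map)
open import Data.List.Relation.Unary.Any using (here; there)
open import Data.List.Relation.Unary.All as All using (all?)
open import Data.List.Membership.Propositional.Properties using (∈-map⁻)
import Data.List.Membership.DecPropositional as DecMembership
open import Data.Nat
open import Data.Nat.Properties
open import Data.Nat.Divisibility using (_∣_; ∣⇒≤; ∣-refl; ∣1⇒≡1; m∣m*n; ∣m+n∣m⇒∣n)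
open import Data.Nat.Primality using (irreducible[2])
open import Data.Product using (_×_; _,_)
open import Data.Product.Properties using (≡-dec)
open import Data.Sum using (inj₁; inj₂)
open import Relation.Binary using (tri<; tri≈; tri>)
open import Relation.Binary.PropositionalEquality
open import Relation.Nullary.Decidable using (True; toWitness; _×-dec_)
open import Relation.Unary using (Pred; Decidable)
open import Level using (Level)

private
  variable
    ℓ ℓ′ : Level
    A : Set ℓ
    a b k m n o : ℕ

lookup-decided : {P : Pred A ℓ′} (P? : Decidable P) (xs : List A) →
                 {True (all? P? xs)} → ∀ {x} → x ∈ xs → P x
lookup-decided P? xs {ok} = All.lookup (toWitness ok)

m*n≡o⇒m∣o : m * n ≡ o → m ∣ o
m*n≡o⇒m∣o {n = n} eq = subst (_ ∣_) eq (m∣m*n n)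

n∣n+m⇒n∣m : n ∣ n + m → n ∣ m
n∣n+m⇒n∣m n∣n+m = ∣m+n∣m⇒∣n n∣n+m ∣-refl

n∣m+n⇒n∣m : ∀ m → n ∣ m + n → n ∣ m
n∣m+n⇒n∣m {n} m n∣m+n = n∣n+m⇒n∣m (subst (n ∣_) (+-comm m n) n∣m+n)

sucDivisorPairs : List (ℕ × ℕ)
sucDivisorPairs = (1 , 1) ∷ (1 , 2) ∷ (2 , 1) ∷ (2 , 3) ∷ (3 , 2) ∷ []

sucDivisorPair-∈ : a ∣ suc b → b ∣ suc a → (a , b) ∈ sucDivisorPairs
sucDivisorPair-∈ {a} {b} a∣1+b b∣1+a with <-cmp a b
... | tri≈ _ refl _ with ∣1⇒≡1 (n∣m+n⇒n∣m 1 a∣1+b)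
...   | refl = here refl
sucDivisorPair-∈ {a} {b} a∣1+b b∣1+a | tri< a<b _ _
  with ≤-antisym a<b (∣⇒≤ b∣1+a)
... | refl with irreducible[2] (n∣m+n⇒n∣m 2 a∣1+b)
...   | inj₁ refl = there (here refl)
...   | inj₂ refl = there (there (there (here refl)))
sucDivisorPair-∈ {a} {b} a∣1+b b∣1+a | tri> _ _ b<a
  with ≤-antisym b<a (∣⇒≤ a∣1+b)
... | refl with irreducible[2] (n∣m+n⇒n∣m 2 b∣1+a)
...   | inj₁ refl = there (there (here refl))
...   | inj₂ refl = there (there (there (there (here refl))))

m+n+1≡m+suc[n] : ∀ m n → m + n + 1 ≡ m + suc n
m+n+1≡m+suc[n] m n = trans (+-assoc m n 1) (cong (m +_) (+-comm n 1))

m*n≡o⇒m+m≤o : ∀ m → 2 ≤ n → m * n ≡ o → m + m ≤ o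
m*n≡o⇒m+m≤o {n} m 2≤n refl = begin
  m + m        ≡⟨ cong (m +_) (sym (+-identityʳ m)) ⟩
  2 * m        ≡⟨ *-comm 2 m ⟩
  m * 2        ≤⟨ *-monoʳ-≤ m 2≤n ⟩
  m * n        ∎
  where open ≤-Reasoning

+-≤-from-doubles : ∀ m n → m + m ≤ o → n + n ≤ o → m + n ≤ o
+-≤-from-doubles m n m+m≤o n+n≤o with ≤-total m n
... | inj₁ m≤n = ≤-trans (+-monoˡ-≤ n m≤n) n+n≤o
... | inj₂ n≤m = ≤-trans (+-monoʳ-≤ m n≤m) m+m≤o

Triple : Set
Triple = ℕ × ℕ × ℕ

xPart : Tuple → Triple
xPart (x₁ , x₂ , x₃ , _) = x₁ , x₂ , x₃

listedXParts : List Triple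
listedXParts = map xPart solutionList

open DecMembership {A = Triple} (≡-dec _≟_ (≡-dec _≟_ _≟_)) using (_∈?_)

sucDivisorPair-image-∈ : (f : ℕ × ℕ → Triple) →
                         {True (all? (λ p → f p ∈? listedXParts) sucDivisorPairs)} →
                         a ∣ suc b → b ∣ suc a → f (a , b) ∈ listedXParts
sucDivisorPair-image-∈ f {ok} a∣1+b b∣1+a =
  lookup-decided (λ p → f p ∈? listedXParts) sucDivisorPairs {ok}
    (sucDivisorPair-∈ a∣1+b b∣1+a)

all-y≥2⇒all-x≡1 : ∀ {x₁ x₂ x₃ y₁ y₂ y₃} →
                  1 ≤ x₁ → 1 ≤ x₂ → 1 ≤ x₃ → 2 ≤ y₁ → 2 ≤ y₂ → 2 ≤ y₃ →
                  x₁ * y₁ ≡ x₂ + 1 → x₂ * y₂ ≡ x₁ + x₃ → x₃ * y₃ ≡ x₂ + 1 →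
                  (x₁ , x₂ , x₃) ≡ (1 , 1 , 1)
all-y≥2⇒all-x≡1 {x₁} {x₂} {x₃} 1≤x₁ 1≤x₂ 1≤x₃ 2≤y₁ 2≤y₂ 2≤y₃ e₁ e₂ e₃
  with ≤-antisym x₁≤1 1≤x₁ | ≤-antisym x₂≤1 1≤x₂ | ≤-antisym x₃≤1 1≤x₃
  where
  x₁+x₃≤x₂+1 : x₁ + x₃ ≤ x₂ + 1
  x₁+x₃≤x₂+1 =
    +-≤-from-doubles x₁ x₃ (m*n≡o⇒m+m≤o x₁ 2≤y₁ e₁) (m*n≡o⇒m+m≤o x₃ 2≤y₃ e₃)
  x₂≤1 : x₂ ≤ 1
  x₂≤1 = +-cancelˡ-≤ x₂ x₂ 1 (≤-trans (m*n≡o⇒m+m≤o x₂ 2≤y₂ e₂) x₁+x₃≤x₂+1)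
  x₁+x₃≤2 : x₁ + x₃ ≤ 1 + 1
  x₁+x₃≤2 = ≤-trans x₁+x₃≤x₂+1 (+-monoˡ-≤ 1 x₂≤1)
  x₁≤1 : x₁ ≤ 1
  x₁≤1 = +-cancelʳ-≤ 1 x₁ 1 (≤-trans (+-monoʳ-≤ x₁ 1≤x₃) x₁+x₃≤2)
  x₃≤1 : x₃ ≤ 1
  x₃≤1 = +-cancelˡ-≤ 1 x₃ 1 (≤-trans (+-monoˡ-≤ x₃ 1≤x₁) x₁+x₃≤2)
... | refl | refl | refl = refl

xPart-∈ : ∀ {t} → IsPositiveSolution t → xPart t ∈ listedXParts
xPart-∈ {x₁ , x₂ , x₃ , 1 , _ , _} (_ , e₁ , e₂ , e₃) with trans (sym (*-identityʳ x₁)) e₁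
... | refl = sucDivisorPair-image-∈ (λ (a , b) → a + 1 , a , b)
               (n∣n+m⇒n∣m (m*n≡o⇒m∣o (trans e₂ (+-assoc x₂ 1 x₃))))
               (m*n≡o⇒m∣o (trans e₃ (+-comm x₂ 1)))
xPart-∈ {x₁ , x₂ , x₃ , _ , _ , 1} (_ , e₁ , e₂ , e₃) with trans (sym (*-identityʳ x₃)) e₃
... | refl = sucDivisorPair-image-∈ (λ (a , b) → a , b , b + 1)
               (m*n≡o⇒m∣o (trans e₁ (+-comm x₂ 1)))
               (n∣n+m⇒n∣m (m*n≡o⇒m∣o (trans e₂ x₁+[x₂+1]≡x₂+suc[x₁])))
  where
  x₁+[x₂+1]≡x₂+suc[x₁] : x₁ + (x₂ + 1) ≡ x₂ + suc x₁
  x₁+[x₂+1]≡x₂+suc[x₁] = trans (+-comm x₁ (x₂ + 1)) (+-assoc x₂ 1 x₁)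
xPart-∈ {x₁ , x₂ , x₃ , _ , 1 , _} (_ , e₁ , e₂ , e₃) with trans (sym (*-identityʳ x₂)) e₂
... | refl = sucDivisorPair-image-∈ (λ (a , b) → a , a + b , b)
               (n∣n+m⇒n∣m (m*n≡o⇒m∣o (trans e₁ (m+n+1≡m+suc[n] x₁ x₃))))
               (n∣n+m⇒n∣m (m*n≡o⇒m∣o (trans e₃ x₁+x₃+1≡x₃+suc[x₁])))
  where
  x₁+x₃+1≡x₃+suc[x₁] : x₁ + x₃ + 1 ≡ x₃ + suc x₁
  x₁+x₃+1≡x₃+suc[x₁] = trans (cong (_+ 1) (+-comm x₁ x₃)) (m+n+1≡m+suc[n] x₃ x₁)
xPart-∈ {_ , _ , _ , 2+ _ , 2+ _ , 2+ _} ((1≤x₁ , 1≤x₂ , 1≤x₃ , _) , e₁ , e₂ , e₃)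
  with all-y≥2⇒all-x≡1 1≤x₁ 1≤x₂ 1≤x₃ (m≤m+n 2 _) (m≤m+n 2 _) (m≤m+n 2 _) e₁ e₂ e₃
... | refl = here refl
xPart-∈ {_ , _ , _ , 0 , _ , _} ((_ , _ , _ , () , _ , _) , _)
xPart-∈ {_ , _ , _ , _ , 0 , _} ((_ , _ , _ , _ , () , _) , _)
xPart-∈ {_ , _ , _ , _ , _ , 0} ((_ , _ , _ , _ , _ , ()) , _)

quotient-unique : 1 ≤ m → m * n ≡ o → m * k ≡ o → n ≡ k
quotient-unique {m} {n} {k = k} 1≤m e e′ =
  *-cancelˡ-≡ n k m {{>-nonZero 1≤m}} (trans e (sym e′))

positiveSolution-unique : ∀ {t s} → IsPositiveSolution t → IsPositiveSolution s →
                          xPart t ≡ xPart s → t ≡ s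
positiveSolution-unique ((p₁ , _ , p₃ , _) , e₁ , e₂ , e₃) ((_ , p₂ , _) , e₁′ , e₂′ , e₃′) refl
  with quotient-unique p₁ e₁ e₁′ | quotient-unique p₂ e₂ e₂′ | quotient-unique p₃ e₃ e₃′
... | refl | refl | refl = refl

isPositiveSolution? : Decidable IsPositiveSolution
isPositiveSolution? (x₁ , x₂ , x₃ , y₁ , y₂ , y₃) =
  (1 ≤? x₁ ×-dec 1 ≤? x₂ ×-dec 1 ≤? x₃ ×-dec 1 ≤? y₁ ×-dec 1 ≤? y₂ ×-dec 1 ≤? y₃) ×-dec
  (x₁ * y₁ ≟ x₂ + 1 ×-dec x₂ * y₂ ≟ x₁ + x₃ ×-dec x₃ * y₃ ≟ x₂ + 1)

listed⇒positiveSolution : ∀ {t} → t ∈ solutionList → IsPositiveSolution t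
listed⇒positiveSolution = lookup-decided isPositiveSolution? solutionList

positiveSolution⇒listed : ∀ {t} → IsPositiveSolution t → t ∈ solutionList
positiveSolution⇒listed sol with ∈-map⁻ xPart (xPart-∈ sol)
... | s , s∈ , xPart[t]≡xPart[s] =
  subst (_∈ solutionList) (sym t≡s) s∈
  where
  t≡s = positiveSolution-unique sol (listed⇒positiveSolution s∈) xPart[t]≡xPart[s]

propositionA4 : (t : Tuple) → IsPositiveSolution t ⇔ t ∈ solutionList
propositionA4 t = mk⇔ positiveSolution⇒listed listed⇒positiveSolution
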